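{- Let $L$ be a first-order language, $\Gamma$ a set of unary $L$-types, $\{M_i:i\in I\}$ a family of $L$-structures each omitting every type in $\Gamma$, and $U$ an ultrafilter on $I$. If $U$ is $\chi$-complete, where $\chi>|\Gamma|$ and $\chi>|p|$ for all $p\in\Gamma$, then $\prod^\Gamma M_i/U=\prod M_i/U$.
   Context: A unary $L$-type is a set of $L$-formulas in one free variable $x$. A choice function on $\Gamma$ is a map $\mathcal{C}$ assigning to each $p\in\Gamma$ a formula $\mathcal{C}(p)\in p$. $\prod^\Gamma M_i$ is the set of $f\in\prod_{i\in I}M_i$ for which there are $X_f\in U$ and a choice function $\mathcal{C}$ with $M_i\models\neg\mathcal{C}(p)(f(i))$ for all $p\in\Gamma$ and $i\in X_f$; $\prod^\Gamma M_i/U=\{[f]_U:f\in\prod^\Gamma M_i\}\subseteq\prod M_i/U$. $U$ is $\chi$-complete if it is closed under intersections of fewer than $\chi$ members. -}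

module Defs where

open import Data.Nat using (ℕ; suc)
open import Data.Fin using (Fin; zero; suc)
open import Data.Empty using (⊥)
open import Data.Unit using (⊤)
open import Data.Product using (Σ; _×_; ∃)
open import Data.Sum using (_⊎_)
open import Relation.Nullary using (¬_; Dec)
open import Relation.Unary using (Pred; _∈_; _⊆_; _∩_; ∁)
open import Relation.Binary.PropositionalEquality using (_≡_)
open import Function.Bundles using (_↣_)
open import Level using (0ℓ)

-- Classical metatheory (the paper works in ZFC)

LEM : Set₁
LEM = (P : Set) → Dec P

record Language : Set₁ where
  field
    Func      : Set
    funcArity : Func → ℕ
    Rel       : Set
    relArity  : Rel → ℕ

module _ (L : Language) where
  open Language L

  data Term (n : ℕ) : Set where
    var  : Fin n → Term n
    func : (f : Func) → (Fin (funcArity f) → Term n) → Term n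

  data Formula (n : ℕ) : Set where
    equal  : Term n → Term n → Formula n
    rel    : (r : Rel) → (Fin (relArity r) → Term n) → Formula n
    falsum : Formula n
    neg    : Formula n → Formula n
    and    : Formula n → Formula n → Formula n
    or     : Formula n → Formula n → Formula n
    imp    : Formula n → Formula n → Formula n
    all    : Formula (suc n) → Formula n
    ex     : Formula (suc n) → Formula n

  record Structure : Set₁ where
    field
      Carrier : Set
      funcs   : (f : Func) → (Fin (funcArity f) → Carrier) → Carrier
      rels    : (r : Rel) → (Fin (relArity r) → Carrier) → Set

  module _ (M : Structure) where
    open Structure M

    extend : ∀ {n} → Carrier → (Fin n → Carrier) → Fin (suc n) → Carrier
    extend a ρ zero    = a
    extend a ρ (suc k) = ρ k

    evalTerm : ∀ {n} → (Fin n → Carrier) → Term n → Carrier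
    evalTerm ρ (var k)     = ρ k
    evalTerm ρ (func f ts) = funcs f (λ k → evalTerm ρ (ts k))

    Sat : ∀ {n} → (Fin n → Carrier) → Formula n → Set
    Sat ρ (equal s t) = evalTerm ρ s ≡ evalTerm ρ t
    Sat ρ (rel r ts)  = rels r (λ k → evalTerm ρ (ts k))
    Sat ρ falsum      = ⊥
    Sat ρ (neg φ)     = ¬ Sat ρ φ
    Sat ρ (and φ ψ)   = Sat ρ φ × Sat ρ ψ
    Sat ρ (or φ ψ)    = Sat ρ φ ⊎ Sat ρ ψ
    Sat ρ (imp φ ψ)   = Sat ρ φ → Sat ρ ψ
    Sat ρ (all φ)     = (a : Carrier) → Sat (extend a ρ) φ
    Sat ρ (ex φ)      = Σ Carrier (λ a → Sat (extend a ρ) φ)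

    Sat₁ : Carrier → Formula 1 → Set
    Sat₁ a φ = Sat (λ _ → a) φ

  -- A unary L-type: a set of formulas in one free variable, given as an
  -- indexed family  { formula k : k ∈ Idx }  (|p| ≤ |Idx|).
  record UnaryType : Set₁ where
    field
      Idx     : Set
      formula : Idx → Formula 1
  open UnaryType public

  Realizes : (M : Structure) → Structure.Carrier M → UnaryType → Set
  Realizes M a p = (k : Idx p) → Sat₁ M a (formula p k)

  Omits : Structure → UnaryType → Set
  Omits M p = ¬ Σ (Structure.Carrier M) (λ a → Realizes M a p)

  -- A set Γ of unary types, given as an indexed family (|Γ| ≤ |TIdx|).
  record TypeSet : Set₁ where
    field
      TIdx : Set
      type : TIdx → UnaryType
  open TypeSet public

  ChoiceFunction : TypeSet → Set
  ChoiceFunction Γ = (g : TIdx Γ) → Idx (type Γ g)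

record IsUltrafilter {I : Set} (U : Pred (Pred I 0ℓ) 0ℓ) : Set₁ where
  field
    full      : (λ _ → ⊤) ∈ U
    proper    : ¬ ((λ _ → ⊥) ∈ U)
    upward    : ∀ {X Y : Pred I 0ℓ} → X ∈ U → X ⊆ Y → Y ∈ U
    intersect : ∀ {X Y : Pred I 0ℓ} → X ∈ U → Y ∈ U → (X ∩ Y) ∈ U
    ultra     : ∀ (X : Pred I 0ℓ) → X ∈ U ⊎ ∁ X ∈ U

_<card_ : Set → Set → Set
A <card B = (A ↣ B) × ¬ (B ↣ A)

-- U is χ-complete (χ = |Χ|): closed under intersections of fewer than χ members
IsComplete : {I : Set} → Pred (Pred I 0ℓ) 0ℓ → (Χ : Set) → Set₁
IsComplete {I} U Χ =
  (K : Set) → K <card Χ → (A : K → Pred I 0ℓ) →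
  ((k : K) → A k ∈ U) → (λ i → (k : K) → A k i) ∈ U

module _ (L : Language) {I : Set} (M : I → Structure L) (U : Pred (Pred I 0ℓ) 0ℓ) where

  Prod : Set
  Prod = (i : I) → Structure.Carrier (M i)

  _≈U_ : Prod → Prod → Set
  f ≈U g = (λ i → f i ≡ g i) ∈ U

  InΓProd : TypeSet L → Prod → Set₁
  InΓProd Γ f =
    Σ (Pred I 0ℓ) λ X → X ∈ U × Σ (ChoiceFunction L Γ) λ C →
      (g : TIdx Γ) → (i : I) → X i →
        Sat₁ L (M i) (f i) (neg (formula (type Γ g) (C g)))

  -- ∏ M_i/U ⊆ ∏^Γ M_i/U  (the reverse inclusion holds by definition)
  ΓUltraproductIsFull : TypeSet L → Set₁
  ΓUltraproductIsFull Γ = (f : Prod) → Σ Prod λ g → InΓProd Γ g × (f ≈U g)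

module Submission where

-- Idea: every f ∈ ∏ M_i is already in ∏^Γ M_i.  Fix p ∈ Γ.  Since M_i omits
-- p, for every i some formula of p fails at f(i); so I is the union, over
-- φ ∈ p, of the sets A_φ = { i : M_i ⊨ ¬φ(f(i)) }.  A χ-complete ultrafilter
-- that contains a union of fewer than χ sets contains one of them, so we may
-- choose C(p) ∈ p with A_{C(p)} ∈ U.  By completeness again (|Γ| < χ) the
-- intersection X_f of the sets A_{C(p)}, p ∈ Γ, lies in U, witnessing
-- f ∈ ∏^Γ M_i.

open import Defs
open import Relation.Unary using (Pred; _∈_)
open import Level using (0ℓ)
open import Data.Product using (Σ; _,_; proj₁; proj₂)
open import Data.Sum using (inj₁; inj₂)
open import Data.Empty using (⊥-elim)
open import Relation.Nullary using (yes; no; ¬_)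
open import Relation.Binary.PropositionalEquality using (_≡_; refl)

dne : LEM → {P : Set} → ¬ ¬ P → P
dne lem {P} ¬¬p with lem P
... | yes p = p
... | no ¬p = ⊥-elim (¬¬p ¬p)

omittedTypeFails : LEM → (L : Language) (M : Structure L) (p : UnaryType L)
  → Omits L M p
  → (a : Structure.Carrier M) → Σ (Idx p) λ k → ¬ Sat₁ L M a (formula p k)
omittedTypeFails lem L M p omits a with lem (Σ (Idx p) λ k → ¬ Sat₁ L M a (formula p k))
... | yes failing = failing
... | no noneFails = ⊥-elim (omits (a , λ k → dne lem λ fails → noneFails (k , fails)))

-- A χ-complete ultrafilter containing the union of fewer than χ sets
-- contains one of them: otherwise it contains all their complements,
-- hence (by completeness) their intersection, which misses the union.
completeUltrafilterUnion : LEM → {I : Set} (U : Pred (Pred I 0ℓ) 0ℓ)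
  → IsUltrafilter U → (Χ : Set) → IsComplete U Χ
  → (K : Set) → K <card Χ → (A : K → Pred I 0ℓ)
  → (λ i → Σ K λ k → A k i) ∈ U
  → Σ K λ k → A k ∈ U
completeUltrafilterUnion lem U uf Χ complete K K<Χ A unionInU
  with lem (Σ K λ k → A k ∈ U)
... | yes someMember = someMember
... | no noMember =
  ⊥-elim (proper (upward (intersect unionInU complementsInU)
                         (λ { ((k , aₖ) , notInAny) → notInAny k aₖ })))
  where
  open IsUltrafilter uf

  complementInU : (k : K) → (λ i → ¬ A k i) ∈ U
  complementInU k with ultra (A k)
  ... | inj₁ member = ⊥-elim (noMember (k , member))
  ... | inj₂ complement = complement

  complementsInU : (λ i → (k : K) → ¬ A k i) ∈ U
  complementsInU = complete K K<Χ (λ k i → ¬ A k i) complementInU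

everyElementInΓProd : LEM → (L : Language) (Γ : TypeSet L) (I : Set) (M : I → Structure L)
  → ((i : I) (g : TIdx Γ) → Omits L (M i) (type Γ g))
  → (U : Pred (Pred I 0ℓ) 0ℓ) → IsUltrafilter U
  → (Χ : Set) → IsComplete U Χ
  → TIdx Γ <card Χ → ((g : TIdx Γ) → Idx (type Γ g) <card Χ)
  → (f : Prod L M U) → InΓProd L M U Γ f
everyElementInΓProd lem L Γ I M omits U uf Χ complete Γ<Χ p<Χ f =
  X , XInU , C , λ g i x → x g
  where
  open IsUltrafilter uf

  A : (g : TIdx Γ) → Idx (type Γ g) → Pred I 0ℓ
  A g k i = ¬ Sat₁ L (M i) (f i) (formula (type Γ g) k)

  coverInU : (g : TIdx Γ) → (λ i → Σ (Idx (type Γ g)) λ k → A g k i) ∈ U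
  coverInU g = upward full λ {i} _ → omittedTypeFails lem L (M i) (type Γ g) (omits i g) (f i)

  chosen : (g : TIdx Γ) → Σ (Idx (type Γ g)) λ k → A g k ∈ U
  chosen g = completeUltrafilterUnion lem U uf Χ complete (Idx (type Γ g)) (p<Χ g) (A g) (coverInU g)

  C : ChoiceFunction L Γ
  C g = proj₁ (chosen g)

  X : Pred I 0ℓ
  X i = (g : TIdx Γ) → A g (C g) i

  XInU : X ∈ U
  XInU = complete (TIdx Γ) Γ<Χ (λ g → A g (C g)) (λ g → proj₂ (chosen g))

theorem4p6 : LEM → (L : Language) (Γ : TypeSet L) (I : Set) (M : I → Structure L)
    → ((i : I) (g : TIdx Γ) → Omits L (M i) (type Γ g))
    → (U : Pred (Pred I 0ℓ) 0ℓ) → IsUltrafilter U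
    → (Χ : Set) → IsComplete U Χ
    → TIdx Γ <card Χ → ((g : TIdx Γ) → Idx (type Γ g) <card Χ)
    → ΓUltraproductIsFull L M U Γ
theorem4p6 lem L Γ I M omits U uf Χ complete Γ<Χ p<Χ f =
  f , everyElementInΓProd lem L Γ I M omits U uf Χ complete Γ<Χ p<Χ f , fullInU
  where
  fullInU : (λ i → f i ≡ f i) ∈ U
  fullInU = IsUltrafilter.upward uf (IsUltrafilter.full uf) (λ _ → refl)
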